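{- Let $G=(A\cup B,E)$ be an instance of the strongly stable matching problem and let $M$ be a strongly stable matching of $G$. Then $[M]=\bigvee U(M)$.
   Context: An instance of the strongly stable matching problem is a finite bipartite graph $G=(A\cup B,E)$ (vertices of $A$ are "men", of $B$ "women") in which every vertex $v$ has a preference list: its neighbours are partitioned into disjoint ties (possibly singletons) which are linearly ordered. For neighbours $x,y$ of $v$ write $x\succ_v y$ if $x$ lies in a strictly earlier tie than $y$, $x=_v y$ if in the same tie, $x\succeq_v y$ if either. A matching is a set of pairwise vertex-disjoint edges; $M(v)$ is the partner of $v$. An edge $e\in E\setminus M$ blocks $M$ if its endpoints can be labelled $x,y$ with ($x$ unmatched or $y\succ_x M(x)$) and ($y$ unmatched or $x\succeq_y M(y)$); $M$ is strongly stable if no edge blocks it. All strongly stable matchings match the same vertices. For strongly stable $M,N$: $M\succeq N$ ($M$ dominates $N$) if $M(m)\succeq_m N(m)$ for every matched man $m$; $M\sim N$ if $M(m)=_m N(m)$ for every matched man $m$; $[M]$ is the $\sim$-class of $M$, and $[M]\succeq[N]$ iff $M\succeq N$. The operation $M\vee N$ is the matching containing, for each matched man $m$, the edge $(m,N(m))$ if $M(m)\succ_m N(m)$ and $(m,M(m))$ otherwise; it is a strongly stable matching, and $[M]\vee[N]:=[M\vee N]$ is well defined. For a nonempty finite set $S$ of classes, $\bigvee S$ denotes the iterated $\vee$ of its elements. For an edge $(a,b)$ (with $a\in A$) contained in some strongly stable matching, let $N$ be a strongly stable matching containing $(a,b)$ that dominates every strongly stable matching containing $(a,b)$ (such $N$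 exists); define $M(a,b):=[N]$. For a strongly stable matching $M$, $U(M)=\{M(a,b):(a,b)\in M\}$. -}

module Defs where

open import Data.Nat using (ℕ; _<_; _≤_)
open import Data.Fin using (Fin)
open import Data.Product using (Σ; _×_; _,_)
open import Data.Sum using (_⊎_)
open import Data.List using (List; foldl)
open import Relation.Nullary using (¬_)
open import Relation.Binary.PropositionalEquality using (_≡_)

-- An instance: men Fin nA, women Fin nB, edge relation E, and preference
-- lists with ties given by ranks: for a neighbour y of x, rk x y is the
-- position of the tie containing y (smaller = better, equal = same tie).
-- Values of rk on non-neighbours are irrelevant.
record Instance : Set₁ where
  field
    nA  : ℕ
    nB  : ℕ
    E   : Fin nA → Fin nB → Set
    rkA : Fin nA → Fin nB → ℕ
    rkB : Fin nB → Fin nA → ℕ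

module _ (G : Instance) where
  open Instance G

  Rel : Set₁
  Rel = Fin nA → Fin nB → Set

  record IsMatching (M : Rel) : Set where
    field
      inE  : ∀ a b → M a b → E a b
      uniA : ∀ a b b' → M a b → M a b' → b ≡ b'
      uniB : ∀ a a' b → M a b → M a' b → a ≡ a'

  UnmatchedA : Rel → Fin nA → Set
  UnmatchedA M a = ∀ b → ¬ M a b

  UnmatchedB : Rel → Fin nB → Set
  UnmatchedB M b = ∀ a → ¬ M a b

  StrictA : Rel → Fin nA → Fin nB → Set
  StrictA M a b = UnmatchedA M a ⊎ Σ (Fin nB) (λ b' → M a b' × rkA a b < rkA a b')

  WeakA : Rel → Fin nA → Fin nB → Set
  WeakA M a b = UnmatchedA M a ⊎ Σ (Fin nB) (λ b' → M a b' × rkA a b ≤ rkA a b')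

  StrictB : Rel → Fin nA → Fin nB → Set
  StrictB M a b = UnmatchedB M b ⊎ Σ (Fin nA) (λ a' → M a' b × rkB b a < rkB b a')

  WeakB : Rel → Fin nA → Fin nB → Set
  WeakB M a b = UnmatchedB M b ⊎ Σ (Fin nA) (λ a' → M a' b × rkB b a ≤ rkB b a')

  -- (a,b) ∈ E ∖ M blocks M (labelling x=a,y=b or x=b,y=a)
  Blocks : Rel → Fin nA → Fin nB → Set
  Blocks M a b = E a b × ¬ M a b ×
    ((StrictA M a b × WeakB M a b) ⊎ (StrictB M a b × WeakA M a b))

  StronglyStable : Rel → Set
  StronglyStable M = IsMatching M × (∀ a b → ¬ Blocks M a b)

  Dominates : Rel → Rel → Set
  Dominates M N = ∀ a b b' → M a b → N a b' → rkA a b ≤ rkA a b'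

  Equiv : Rel → Rel → Set
  Equiv M N = ∀ a b b' → M a b → N a b' → rkA a b ≡ rkA a b'

  Join : Rel → Rel → Rel
  Join M N a b =
    (N a b × Σ (Fin nB) (λ b' → M a b' × rkA a b' < rkA a b))
    ⊎ (M a b × ¬ Σ (Fin nB) (λ b' → N a b' × rkA a b < rkA a b'))

  -- N is a strongly stable matching containing (a,b) that dominates every
  -- strongly stable matching containing (a,b); then M(a,b) = [N]
  IsTopFor : Fin nA → Fin nB → Rel → Set₁
  IsTopFor a b N = StronglyStable N × N a b ×
    (∀ (N' : Rel) → StronglyStable N' → N' a b → Dominates N N')

  BigJoin : (Fin nA → Fin nB → Rel) → (Fin nA × Fin nB) →
            List (Fin nA × Fin nB) → Rel
  BigJoin f (a₀ , b₀) es = foldl (λ acc e → Join acc (f (Data.Product.proj₁ e) (Data.Product.proj₂ e))) (f a₀ b₀) es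

{-# OPTIONS --safe #-}
module Submission where

-- The operation ∨ gives every man the worse of his two partners. Hence a man's
-- partner in ⋁ U(M) is his partner in some top matching N(a', b') with
-- (a', b') ∈ M; that matching dominates M, so this partner is at least as good
-- as M(a). Conversely the partner is no better than his partner in any of the
-- joined matchings, in particular than b = M(a) in N(a, b).

open import Defs
open import Data.Fin using (Fin)
open import Data.Product using (_×_; _,_; ∃-syntax; proj₁; proj₂; uncurry)
open import Data.Sum as Sum using (_⊎_; inj₁; inj₂)
open import Data.List using (List; _∷_; []; foldl)
open import Data.List.Membership.Propositional using (_∈_)
open import Data.List.Relation.Unary.Any using (here; there)
open import Data.Nat using (_≤_)
open import Data.Nat.Properties using (≤-refl; ≤-reflexive; ≤-trans; <⇒≤; ≮⇒≥; ≤-antisym)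
open import Relation.Binary.PropositionalEquality using (refl; cong)

module Joins (G : Instance) where
  open Instance G

  module _ (M N : Rel G) {a : Fin nA} {b : Fin nB} where

    Join-source : Join G M N a b → M a b ⊎ N a b
    Join-source (inj₁ (nab , _)) = inj₂ nab
    Join-source (inj₂ (mab , _)) = inj₁ mab

    Join-rank≥ˡ : Join G M N a b → ∃[ c ] M a c × rkA a c ≤ rkA a b
    Join-rank≥ˡ (inj₁ (_ , c , mac , c<b)) = c , mac , <⇒≤ c<b
    Join-rank≥ˡ (inj₂ (mab , _))           = b , mab , ≤-refl

    Join-rank≥ʳ : ∀ {c} → IsMatching G N → N a c → Join G M N a b → rkA a c ≤ rkA a b
    Join-rank≥ʳ N-matching nac (inj₁ (nab , _)) =
      ≤-reflexive (cong (rkA a) (IsMatching.uniA N-matching _ _ _ nac nab))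
    Join-rank≥ʳ {c} N-matching nac (inj₂ (_ , no-worse)) = ≮⇒≥ (λ b<c → no-worse (c , nac , b<c))

  module _ {I : Set} (F : I → Rel G) where

    JoinAll : Rel G → List I → Rel G
    JoinAll = foldl (λ R i → Join G R (F i))

    JoinAll-source : ∀ R is {a b} → JoinAll R is a b → R a b ⊎ ∃[ i ] i ∈ is × F i a b
    JoinAll-source R []       j = inj₁ j
    JoinAll-source R (i ∷ is) j with JoinAll-source (Join G R (F i)) is j
    ... | inj₁ joined           = Sum.map₂ (λ fab → i , here refl , fab) (Join-source R (F i) joined)
    ... | inj₂ (k , k∈is , fab) = inj₂ (k , there k∈is , fab)

    JoinAll-rank≥-init : ∀ R is {a b} → JoinAll R is a b → ∃[ c ] R a c × rkA a c ≤ rkA a b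
    JoinAll-rank≥-init R []       {b = b} j = b , j , ≤-refl
    JoinAll-rank≥-init R (i ∷ is) j with JoinAll-rank≥-init (Join G R (F i)) is j
    ... | d , joined , d≤b with Join-rank≥ˡ R (F i) joined
    ...   | c , rac , c≤d = c , rac , ≤-trans c≤d d≤b

    JoinAll-rank≥-∈ : ∀ R is {i a b c} → i ∈ is → IsMatching G (F i) → F i a c →
                      JoinAll R is a b → rkA a c ≤ rkA a b
    JoinAll-rank≥-∈ R (i ∷ is) (here refl) Fi-matching fac j
      with JoinAll-rank≥-init (Join G R (F i)) is j
    ... | d , joined , d≤b = ≤-trans (Join-rank≥ʳ R (F i) Fi-matching fac joined) d≤b
    JoinAll-rank≥-∈ R (_ ∷ is) (there i∈is) Fi-matching fac j =
      JoinAll-rank≥-∈ (Join G R _) is i∈is Fi-matching fac j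

  module _ (N : Fin nA → Fin nB → Rel G) where

    BigJoin-source : ∀ e es {a b} → BigJoin G N e es a b →
                     ∃[ xy ] xy ∈ e ∷ es × uncurry N xy a b
    BigJoin-source e es j with JoinAll-source (uncurry N) (uncurry N e) es j
    ... | inj₁ nab                = e , here refl , nab
    ... | inj₂ (xy , xy∈es , nab) = xy , there xy∈es , nab

    BigJoin-rank≥ : ∀ e es {x y a b c} → (x , y) ∈ e ∷ es → IsMatching G (N x y) → N x y a c →
                    BigJoin G N e es a b → rkA a c ≤ rkA a b
    BigJoin-rank≥ e es (here refl) N-matching nac j
      with JoinAll-rank≥-init (uncurry N) (uncurry N e) es j
    ... | d , nad , d≤b = ≤-trans (≤-reflexive (cong (rkA _) (IsMatching.uniA N-matching _ _ _ nac nad))) d≤b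
    BigJoin-rank≥ e es (there xy∈es) = JoinAll-rank≥-∈ (uncurry N) (uncurry N e) es xy∈es

lemma4 : (G : Instance) → (M : Rel G) → StronglyStable G M →
         (N : Fin (Instance.nA G) → Fin (Instance.nB G) → Rel G) →
         (∀ a b → M a b → IsTopFor G a b (N a b)) →
         (e : Fin (Instance.nA G) × Fin (Instance.nB G)) →
         (es : List (Fin (Instance.nA G) × Fin (Instance.nB G))) →
         (∀ a b → M a b → (a , b) ∈ e ∷ es) →
         (∀ a b → (a , b) ∈ e ∷ es → M a b) →
         Equiv G M (BigJoin G N e es)
lemma4 G M M-stable N top e es M⊆es es⊆M a b b′ mab joined =
  ≤-antisym b≤b′ b′≤b
  where
  open Instance G
  open Joins G
  N-matching : ∀ {x y} → M x y → IsMatching G (N x y)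
  N-matching mxy = proj₁ (proj₁ (top _ _ mxy))
  N-dominates-M : ∀ {x y} → M x y → Dominates G (N x y) M
  N-dominates-M mxy = proj₂ (proj₂ (top _ _ mxy)) M M-stable mxy
  b≤b′ : rkA a b ≤ rkA a b′
  b≤b′ = BigJoin-rank≥ N e es (M⊆es a b mab) (N-matching mab) (proj₁ (proj₂ (top a b mab))) joined
  b′≤b : rkA a b′ ≤ rkA a b
  b′≤b with BigJoin-source N e es joined
  ... | (x , y) , xy∈es , nab′ = N-dominates-M (es⊆M x y xy∈es) a b′ b nab′ mab
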